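{- Let $C\subset\mathbb{F}^n$ be an $[n,k]$-code over a field $\mathbb{F}$, and $C^\perp$ its dual code. Equip the lattice $L_{[n]}$ of subsets of $[n]$ (rank $\#J$) with the degree $\deg_C(J)=\dim(C\cap\mathbb{F}^{[n]\setminus J})$, and suppose that its canonical polygon is $P_C:[0,n]\to\mathbb{R}$ with slopes $\mu_1>\dots>\mu_N$. Then $L_{[n]}$ with the degree $\deg_{C^\perp}(J)=\dim(C^\perp\cap\mathbb{F}^{[n]\setminus J})$ has canonical polygon $$P_{C^\perp}(x)=P_C(n-x)+n-x-k,\qquad x\in[0,n],$$ with slopes $-1-\mu_N>\dots>-1-\mu_1$. Moreover, if the vertices of $P_C$ correspond to the canonical filtration $\emptyset=J_0\subsetneq J_1\subsetneq\dots\subsetneq J_N=[n]$, then those of $P_{C^\perp}$ correspond to the filtration $\emptyset=[n]\setminus J_N\subsetneq\dots\subsetneq[n]\setminus J_1\subsetneq[n]\setminus J_0=[n]$.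
   Context: $C^\perp$ is the orthogonal of $C$ for the standard bilinear form on $\mathbb{F}^n$. $\mathbb{F}^S\subset\mathbb{F}^n$ denotes the vectors supported in $S$. The degree $\deg_C$ is the one induced by the cosupport Galois connection ($C'\mapsto[n]\setminus\Supp(C')$, $J\mapsto C\cap\mathbb{F}^{[n]\setminus J}$) via $\deg(J)=\dim(J^\circ)$. The canonical polygon is the upper concave envelope of the points $(\#J,\deg(J))$; the slopes are its distinct successive slopes; the canonical filtration is the chain of unique subsets whose points are the polygon's vertices.
   Formalization: The canonical polygons $P_C$ and $P_{C^\perp}$ are defined only at the rationals of $[0,n]$ and take rational values, with rational slopes, instead of being maps $[0,n]\to\mathbb{R}$. -}

module Defs where

open import Level using (Level; _⊔_; suc)
open import Algebra.Bundles using (CommutativeRing)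
open import Data.Nat as ℕ using (ℕ)
open import Data.Integer using (+_)
open import Data.Rational as Q using (ℚ; 0ℚ; 1ℚ)
open import Data.Fin as Fin using (Fin; zero; inject₁; fromℕ)
import Data.Fin.Subset as Sub
open import Data.Fin.Subset using (Subset; ∣_∣)
open import Data.Product using (Σ; ∃; _×_; _,_)
open import Data.Sum using (_⊎_)
open import Relation.Nullary using (¬_)
open import Relation.Unary using (Pred)
open import Relation.Binary.PropositionalEquality using (_≡_)

record Field (c ℓ : Level) : Set (Level.suc (c ⊔ ℓ)) where
  field
    commutativeRing : CommutativeRing c ℓ
  open CommutativeRing commutativeRing public
  field
    1≉0     : ¬ (1# ≈ 0#)
    inverse : ∀ x → ¬ (x ≈ 0#) → ∃ λ y → (x * y) ≈ 1#

module LinearAlgebra {c ℓ} (F : Field c ℓ) where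
  open Field F using (Carrier; _≈_; _+_; _*_; 0#; 1#)

  Vector : ℕ → Set c
  Vector n = Fin n → Carrier

  ∑ : ∀ {n} → (Fin n → Carrier) → Carrier
  ∑ {ℕ.zero}  f = 0#
  ∑ {ℕ.suc n} f = f zero + ∑ (λ i → f (Fin.suc i))

  _≋_ : ∀ {n} → Vector n → Vector n → Set ℓ
  u ≋ v = ∀ i → u i ≈ v i

  0v : ∀ {n} → Vector n
  0v _ = 0#

  ⟨_,_⟩ : ∀ {n} → Vector n → Vector n → Carrier
  ⟨ u , v ⟩ = ∑ (λ i → u i * v i)

  lincomb : ∀ {n d} → (Fin d → Carrier) → (Fin d → Vector n) → Vector n
  lincomb a b i = ∑ (λ j → a j * b j i)

  record Code (n : ℕ) (p : Level) : Set (c ⊔ ℓ ⊔ Level.suc p) where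
    field
      _∈C    : Pred (Vector n) p
      resp   : ∀ {u v} → u ≋ v → u ∈C → v ∈C
      zero∈  : 0v ∈C
      +-closed : ∀ {u v} → u ∈C → v ∈C → (λ i → u i + v i) ∈C
      *-closed : ∀ a {u} → u ∈C → (λ i → a * u i) ∈C

  Dual : ∀ {n p} → Code n p → Pred (Vector n) (c ⊔ ℓ ⊔ p)
  Dual C v = ∀ u → u ∈C → ⟨ u , v ⟩ ≈ 0#
    where open Code C

  -- V ∩ 𝔽^{[n] ∖ J}: vectors of V vanishing on J
  Restrict : ∀ {n p} → Pred (Vector n) p → Subset n → Pred (Vector n) (ℓ ⊔ p)
  Restrict V J v = V v × (∀ i → i Sub.∈ J → v i ≈ 0#)

  LinIndep : ∀ {n d} → (Fin d → Vector n) → Set (c ⊔ ℓ)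
  LinIndep b = ∀ a → lincomb a b ≋ 0v → ∀ j → a j ≈ 0#

  IsBasis : ∀ {n d p} → Pred (Vector n) p → (Fin d → Vector n) → Set (c ⊔ ℓ ⊔ p)
  IsBasis V b = (∀ j → V (b j)) × LinIndep b × (∀ v → V v → ∃ λ a → v ≋ lincomb a b)

  HasDim : ∀ {n p} → Pred (Vector n) p → ℕ → Set (c ⊔ ℓ ⊔ p)
  HasDim V d = ∃ λ (b : Fin d → _) → IsBasis V b

-- Canonical polygons (over ℚ; all vertices have integer abscissae).

ℕ→ℚ : ℕ → ℚ
ℕ→ℚ n = + n Q./ 1

InRange : ℕ → ℚ → Set
InRange n x = (0ℚ Q.≤ x) × (x Q.≤ ℕ→ℚ n)

ConcaveOn : ℕ → (ℚ → ℚ) → Set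
ConcaveOn n P = ∀ x y t → InRange n x → InRange n y → 0ℚ Q.≤ t → t Q.≤ 1ℚ →
  ((t Q.* P x) Q.+ ((1ℚ Q.- t) Q.* P y)) Q.≤ P ((t Q.* x) Q.+ ((1ℚ Q.- t) Q.* y))

Majorizes : ∀ {n} → (Subset n → ℕ) → (ℚ → ℚ) → Set
Majorizes deg P = ∀ J → ℕ→ℚ (deg J) Q.≤ P (ℕ→ℚ ∣ J ∣)

IsCanonicalPolygon : ∀ n → (Subset n → ℕ) → (ℚ → ℚ) → Set
IsCanonicalPolygon n deg P =
  ConcaveOn n P × Majorizes deg P ×
  (∀ Q → ConcaveOn n Q → Majorizes deg Q → ∀ x → InRange n x → P x Q.≤ Q x)

-- value at z of the chord of P between a and b (a < b)
-- written multiplied out: (b-a)·chord(z) = (b-z)·P a + (z-a)·P b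
-- x is a vertex of P: P is not affine on any neighbourhood of x in [0,n],
-- i.e. P x lies strictly above every chord through a < x < b.
IsVertex : ℕ → (ℚ → ℚ) → ℚ → Set
IsVertex n P x = InRange n x ×
  (∀ a b → 0ℚ Q.≤ a → a Q.< x → x Q.< b → b Q.≤ ℕ→ℚ n →
     (((b Q.- x) Q.* P a) Q.+ ((x Q.- a) Q.* P b)) Q.< ((b Q.- a) Q.* P x))

-- P has slopes μ_0 > … > μ_{N-1} (0-indexed), with vertices x_0 < … < x_N
HasSlopes : ℕ → (ℚ → ℚ) → (N : ℕ) → (Fin N → ℚ) → Set
HasSlopes n P N μ =
  (∀ i j → i Fin.< j → μ j Q.< μ i) ×
  Σ (Fin (ℕ.suc N) → ℚ) λ x →
    (x zero ≡ 0ℚ) × (x (fromℕ N) ≡ ℕ→ℚ n) ×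
    (∀ i j → i Fin.< j → x i Q.< x j) ×
    (∀ i → IsVertex n P (x i)) ×
    (∀ y → IsVertex n P y → ∃ λ i → x i ≡ y) ×
    (∀ i → (μ i Q.* (x (Fin.suc i) Q.- x (inject₁ i))) ≡ (P (x (Fin.suc i)) Q.- P (x (inject₁ i))))

IsCanonicalFiltration : ∀ n → (Subset n → ℕ) → (ℚ → ℚ) → (N : ℕ) → (Fin (ℕ.suc N) → Subset n) → Set
IsCanonicalFiltration n deg P N J =
  (J zero ≡ Sub.⊥) × (J (fromℕ N) ≡ Sub.⊤) ×
  (∀ (i : Fin N) → J (inject₁ i) Sub.⊂ J (Fin.suc i)) ×
  (∀ i → IsVertex n P (ℕ→ℚ ∣ J i ∣) × (P (ℕ→ℚ ∣ J i ∣) ≡ ℕ→ℚ (deg (J i)))) ×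
  (∀ y → IsVertex n P y → ∃ λ i → ℕ→ℚ ∣ J i ∣ ≡ y) ×
  (∀ i K → ∣ K ∣ ≡ ∣ J i ∣ → ℕ→ℚ (deg K) ≡ P (ℕ→ℚ ∣ K ∣) → K ≡ J i)

module Submission where

-- Write d(J) = dim (C ∩ 𝔽^([n]∖J)) and d⊥(J) = dim (C⊥ ∩ 𝔽^([n]∖J)). For a generator matrix G of C,
-- C⊥ ∩ 𝔽^([n]∖J) is the kernel of the block of G on the columns outside J, and C ∩ 𝔽^J is isomorphic
-- to the left kernel of that same block, so rank–nullity gives d⊥(J) + k = #([n]∖J) + d([n]∖J).
-- Thus the points (#J, d⊥ J) are the images of the points (#J′, d J′), J′ = [n]∖J, under the affine
-- involution (x, y) ↦ (n − x, y + x − k). Such a map preserves concavity and upper envelopes, maps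
-- vertices to vertices, reverses the order of abscissae and turns a slope μ into −1 − μ.
-- Equality in the field is only a setoid, so pivots cannot be tested for zero: Gaussian elimination
-- runs in the double-negation monad, which is harmless as its conclusions are equalities in ℕ.

open import Defs
open import Level using (_⊔_)
open import Data.Nat as ℕ using (ℕ; zero; suc; _∸_; _≤_; _<_)
open import Data.Fin as Fin using (Fin; zero; suc; opposite; fromℕ; inject₁)
import Data.Fin.Properties as Finₚ
import Data.Nat.Properties as ℕₚ
open import Data.Nat.Induction using (<-rec)
open import Data.Fin.Subset using (Subset; inside; outside; _∈_; _∉_; ⁅_⁆; ∁; ∣_∣; Empty; ⊤) renaming (_-_ to _∖_)
open import Data.Fin.Subset.Properties
  using ( _∈?_; ∈⊤; nonempty?; Empty-unique; p─⊥≡p; p─q⊆p; x∈p∧x≢y⇒x∈p-y; x∈p⇒x∉∁p; x∉∁p⇒x∈p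
        ; ∣p─q∣≤∣p∣; x∈p⇒∣p-x∣<∣p∣; ∣⊥∣≡0; ∣⊤∣≡n; ∣∁p∣≡n∸∣p∣; ∣p∣≤n )
open import Relation.Nullary using (¬_; yes; no)
open import Relation.Nullary.Negation using (DoubleNegation; ¬¬-map; contradiction)
open import Relation.Nullary.Decidable using (¬¬-excluded-middle; decidable-stable)
open import Data.Sum as ⊎ using (_⊎_; inj₁; inj₂)
open import Data.Vec using (_∷_; here; there)
open import Relation.Binary.PropositionalEquality as ≡ using (_≡_; _≢_; cong; cong₂)
open import Relation.Unary using (Pred)
open import Data.Empty using (⊥-elim)
open import Data.Product using (∃; ∃₂; _×_; _,_; proj₁; proj₂)
open import Function using (_∘_)

x∉p∖x : ∀ {n} (x : Fin n) (p : Subset n) → x ∉ p ∖ x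
x∉p∖x zero    (_ ∷ p) ()
x∉p∖x (suc x) (outside ∷ p) (there x∈p∖x) = x∉p∖x x p x∈p∖x
x∉p∖x (suc x) (inside ∷ p)  (there x∈p∖x) = x∉p∖x x p x∈p∖x

suc∣p∖x∣≡∣p∣ : ∀ {n} {x : Fin n} {p : Subset n} → x ∈ p → suc ∣ p ∖ x ∣ ≡ ∣ p ∣
suc∣p∖x∣≡∣p∣ {p = inside ∷ p} here = cong (λ q → suc ∣ q ∣) (p─⊥≡p p)
suc∣p∖x∣≡∣p∣ {p = inside ∷ p}  (there x∈p) = cong suc (suc∣p∖x∣≡∣p∣ x∈p)
suc∣p∖x∣≡∣p∣ {p = outside ∷ p} (there x∈p) = suc∣p∖x∣≡∣p∣ x∈p

∣∖∣-balance : ∀ {m n a b} {R : Subset m} {S : Subset n} {q p} → q ∈ R → p ∈ S →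
  a ℕ.+ ∣ R ∖ q ∣ ≡ ∣ S ∖ p ∣ ℕ.+ b → a ℕ.+ ∣ R ∣ ≡ ∣ S ∣ ℕ.+ b
∣∖∣-balance {a = a} {b} {R} {S} {q} {p} q∈R p∈S eq = begin
  a ℕ.+ ∣ R ∣             ≡⟨ cong (a ℕ.+_) (suc∣p∖x∣≡∣p∣ q∈R) ⟨
  a ℕ.+ suc ∣ R ∖ q ∣     ≡⟨ ℕₚ.+-suc a _ ⟩
  suc (a ℕ.+ ∣ R ∖ q ∣)   ≡⟨ cong suc eq ⟩
  suc (∣ S ∖ p ∣ ℕ.+ b)   ≡⟨ cong (ℕ._+ b) (suc∣p∖x∣≡∣p∣ p∈S) ⟩
  ∣ S ∣ ℕ.+ b             ∎
  where open ≡.≡-Reasoning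

∣p∣≡∣∁q∣⇒∣∁p∣≡∣q∣ : ∀ {n} {p q : Subset n} → ∣ p ∣ ≡ ∣ ∁ q ∣ → ∣ ∁ p ∣ ≡ ∣ q ∣
∣p∣≡∣∁q∣⇒∣∁p∣≡∣q∣ {n} {p} {q} ∣p∣≡∣∁q∣ = begin
  ∣ ∁ p ∣           ≡⟨ ∣∁p∣≡n∸∣p∣ p ⟩
  n ∸ ∣ p ∣         ≡⟨ cong (n ∸_) (≡.trans ∣p∣≡∣∁q∣ (∣∁p∣≡n∸∣p∣ q)) ⟩
  n ∸ (n ∸ ∣ q ∣)   ≡⟨ ℕₚ.m∸[m∸n]≡n (∣p∣≤n q) ⟩
  ∣ q ∣             ∎
  where open ≡.≡-Reasoning

opposite-fromℕ : ∀ n → opposite (fromℕ n) ≡ zero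
opposite-fromℕ zero    = ≡.refl
opposite-fromℕ (suc n) = cong inject₁ (opposite-fromℕ n)

opposite-inject₁ : ∀ {n} (i : Fin n) → opposite (inject₁ i) ≡ suc (opposite i)
opposite-inject₁ {suc n} zero    = ≡.refl
opposite-inject₁ {suc n} (suc i) = cong inject₁ (opposite-inject₁ i)

opposite-reverses-< : ∀ {n} {i j : Fin n} → i Fin.< j → opposite j Fin.< opposite i
opposite-reverses-< {n} {i} {j} i<j rewrite Finₚ.opposite-prop i | Finₚ.opposite-prop j =
  ℕₚ.∸-monoʳ-< (ℕ.s≤s i<j) (Finₚ.toℕ<n j)

-- Level-polymorphic bind and return for ¬¬, which stdlib's ¬¬-Monad (a single level) does not provide.

infixl 1 _>>=_

_>>=_ : ∀ {a b} {A : Set a} {B : Set b} → DoubleNegation A → (A → DoubleNegation B) → DoubleNegation B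
(¬¬a >>= f) ¬b = ¬¬a (λ a → f a ¬b)

pure : ∀ {a} {A : Set a} → A → DoubleNegation A
pure a ¬a = ¬a a

¬¬-∀⊎∃¬ : ∀ {m q} (Q : Pred (Fin m) q) → DoubleNegation ((∀ j → Q j) ⊎ ∃ λ j → ¬ Q j)
¬¬-∀⊎∃¬ {zero}  Q = pure (inj₁ λ ())
¬¬-∀⊎∃¬ {suc m} Q = ¬¬-excluded-middle >>= λ
  { (no ¬Q₀) → pure (inj₂ (zero , ¬Q₀))
  ; (yes Q₀) → ¬¬-∀⊎∃¬ (Q ∘ suc) >>= λ
      { (inj₁ Q₊)        → pure (inj₁ λ { zero → Q₀ ; (suc j) → Q₊ j })
      ; (inj₂ (j , ¬Qj)) → pure (inj₂ (suc j , ¬Qj)) } }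

module _ {c ℓ} (F : Field c ℓ) where
  open Field F hiding (zero)
  open LinearAlgebra F
  open import Algebra.Properties.Semiring.Sum semiring as Sum using (sum)
  open import Relation.Binary.Reasoning.Setoid setoid
  open import Algebra.Properties.CommutativeSemigroup *-commutativeSemigroup as * using (x∙yz≈y∙xz)
  open import Algebra.Properties.CommutativeSemigroup +-commutativeSemigroup as + using ()
  open import Algebra.Properties.Ring ring using (-‿distribˡ-*; -‿distribʳ-*; -1*x≈-x; -‿involutive; -‿+-comm)

  [x-y]+y≈x : ∀ x y → (x - y) + y ≈ x
  [x-y]+y≈x x y = begin
    (x - y) + y   ≈⟨ +-assoc x (- y) y ⟩
    x + (- y + y) ≈⟨ +-congˡ (-‿inverseˡ y) ⟩
    x + 0#        ≈⟨ +-identityʳ x ⟩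
    x             ∎

  -x*y-cong : ∀ {x y x′ y′} → x * y ≈ x′ * y′ → - x * y ≈ - x′ * y′
  -x*y-cong {x} {y} {x′} {y′} xy≈x′y′ =
    trans (sym (-‿distribˡ-* x y)) (trans (-‿cong xy≈x′y′) (-‿distribˡ-* x′ y′))

  ∑≈sum : ∀ {n} (f : Vector n) → ∑ f ≈ sum f
  ∑≈sum {zero}  f = refl
  ∑≈sum {suc n} f = +-congˡ (∑≈sum (λ i → f (suc i)))

  ∑-cong : ∀ {n} {f g : Vector n} → f ≋ g → ∑ f ≈ ∑ g
  ∑-cong {f = f} {g} f≋g = trans (∑≈sum f) (trans (Sum.sum-cong-≋ f≋g) (sym (∑≈sum g)))

  ∑-zero : ∀ {n} {f : Vector n} → f ≋ 0v → ∑ f ≈ 0#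
  ∑-zero {n} f≋0 = trans (∑-cong f≋0) (trans (∑≈sum {n} 0v) (Sum.sum-replicate-zero n))

  ∑-distrib-+ : ∀ {n} (f g : Vector n) → ∑ (λ i → f i + g i) ≈ ∑ f + ∑ g
  ∑-distrib-+ f g = trans (∑≈sum (λ i → f i + g i)) (trans (Sum.∑-distrib-+ f g) (sym (+-cong (∑≈sum f) (∑≈sum g))))

  *-distribˡ-∑ : ∀ {n} a (f : Vector n) → a * ∑ f ≈ ∑ (λ i → a * f i)
  *-distribˡ-∑ a f = trans (*-congˡ (∑≈sum f)) (trans (Sum.*-distribˡ-sum a f) (sym (∑≈sum (λ i → a * f i))))

  *-distribʳ-∑ : ∀ {n} a (f : Vector n) → ∑ f * a ≈ ∑ (λ i → f i * a)
  *-distribʳ-∑ a f = trans (*-congʳ (∑≈sum f)) (trans (Sum.*-distribʳ-sum a f) (sym (∑≈sum (λ i → f i * a))))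

  ∑-comm : ∀ {m n} (f : Fin m → Fin n → Carrier) → ∑ (λ i → ∑ (f i)) ≈ ∑ (λ j → ∑ (λ i → f i j))
  ∑-comm f = begin
    ∑ (λ i → ∑ (f i))            ≈⟨ ∑-cong (λ i → ∑≈sum (f i)) ⟩
    ∑ (λ i → sum (f i))          ≈⟨ ∑≈sum (λ i → sum (f i)) ⟩
    sum (λ i → sum (f i))        ≈⟨ Sum.∑-comm f ⟩
    sum (λ j → sum (λ i → f i j)) ≈⟨ ∑≈sum (λ j → sum (λ i → f i j)) ⟨
    ∑ (λ j → sum (λ i → f i j))  ≈⟨ ∑-cong (λ j → ∑≈sum (λ i → f i j)) ⟨
    ∑ (λ j → ∑ (λ i → f i j))    ∎

  δ : ∀ {n} → Fin n → Vector n
  δ zero    zero    = 1#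
  δ zero    (suc i) = 0#
  δ (suc p) zero    = 0#
  δ (suc p) (suc i) = δ p i

  δ-diag : ∀ {n} (p : Fin n) → δ p p ≈ 1#
  δ-diag zero    = refl
  δ-diag (suc p) = δ-diag p

  δ-off : ∀ {n} {p i : Fin n} → p ≢ i → δ p i ≈ 0#
  δ-off {p = zero}  {zero}  p≢i = ⊥-elim (p≢i ≡.refl)
  δ-off {p = zero}  {suc i} p≢i = refl
  δ-off {p = suc p} {zero}  p≢i = refl
  δ-off {p = suc p} {suc i} p≢i = δ-off (p≢i ∘ cong suc)

  ⟨,⟩-cong : ∀ {n} {u u′ v v′ : Vector n} → u ≋ u′ → v ≋ v′ → ⟨ u , v ⟩ ≈ ⟨ u′ , v′ ⟩
  ⟨,⟩-cong u≋u′ v≋v′ = ∑-cong (λ i → *-cong (u≋u′ i) (v≋v′ i))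

  ⟨,⟩-comm : ∀ {n} (u v : Vector n) → ⟨ u , v ⟩ ≈ ⟨ v , u ⟩
  ⟨,⟩-comm u v = ∑-cong (λ i → *-comm (u i) (v i))

  ⟨,0⟩ : ∀ {n} (u : Vector n) → ⟨ u , 0v ⟩ ≈ 0#
  ⟨,0⟩ u = ∑-zero (λ i → zeroʳ (u i))

  ⟨,+⟩ : ∀ {n} (u v w : Vector n) → ⟨ u , (λ i → v i + w i) ⟩ ≈ ⟨ u , v ⟩ + ⟨ u , w ⟩
  ⟨,+⟩ u v w = trans (∑-cong (λ i → distribˡ (u i) (v i) (w i))) (∑-distrib-+ (λ i → u i * v i) (λ i → u i * w i))

  ⟨,*⟩ : ∀ {n} (u v : Vector n) a → ⟨ u , (λ i → a * v i) ⟩ ≈ a * ⟨ u , v ⟩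
  ⟨,*⟩ u v a = trans (∑-cong (λ i → x∙yz≈y∙xz (u i) a (v i))) (sym (*-distribˡ-∑ a (λ i → u i * v i)))

  ⟨,δ⟩ : ∀ {n} (u : Vector n) p → ⟨ u , δ p ⟩ ≈ u p
  ⟨,δ⟩ {suc n} u zero = begin
    u zero * 1# + ∑ (λ i → u (suc i) * 0#) ≈⟨ +-cong (*-identityʳ _) (∑-zero (λ i → zeroʳ (u (suc i)))) ⟩
    u zero + 0#                             ≈⟨ +-identityʳ _ ⟩
    u zero                                  ∎
  ⟨,δ⟩ {suc n} u (suc p) = begin
    u zero * 0# + ∑ (λ i → u (suc i) * δ p i) ≈⟨ +-cong (zeroʳ _) (⟨,δ⟩ (λ i → u (suc i)) p) ⟩
    0# + u (suc p)                            ≈⟨ +-identityˡ _ ⟩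
    u (suc p)                                 ∎

  ⟨lincomb,⟩ : ∀ {n d} (a : Fin d → Carrier) (b : Fin d → Vector n) v →
    ⟨ lincomb a b , v ⟩ ≈ ∑ (λ j → a j * ⟨ b j , v ⟩)
  ⟨lincomb,⟩ a b v = begin
    ∑ (λ i → ∑ (λ j → a j * b j i) * v i)   ≈⟨ ∑-cong (λ i → *-distribʳ-∑ (v i) (λ j → a j * b j i)) ⟩
    ∑ (λ i → ∑ (λ j → a j * b j i * v i))   ≈⟨ ∑-comm (λ i j → a j * b j i * v i) ⟩
    ∑ (λ j → ∑ (λ i → a j * b j i * v i))   ≈⟨ ∑-cong (λ j → trans (∑-cong (λ i → *-assoc (a j) (b j i) (v i)))
                                                                    (sym (*-distribˡ-∑ (a j) (λ i → b j i * v i)))) ⟩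
    ∑ (λ j → a j * ⟨ b j , v ⟩)             ∎

  shiftAt : ∀ {n} → Fin n → Carrier → Vector n → Vector n
  shiftAt p t v i = v i + t * δ p i

  shiftAt-off : ∀ {n} {p i : Fin n} t v → p ≢ i → shiftAt p t v i ≈ v i
  shiftAt-off t v p≢i = trans (+-congˡ (trans (*-congˡ (δ-off p≢i)) (zeroʳ t))) (+-identityʳ _)

  shiftAt-self : ∀ {n} (p : Fin n) t v → shiftAt p t v p ≈ v p + t
  shiftAt-self p t v = +-congˡ (trans (*-congˡ (δ-diag p)) (*-identityʳ t))

  ⟨,shiftAt⟩ : ∀ {n} (u v : Vector n) p t → ⟨ u , shiftAt p t v ⟩ ≈ ⟨ u , v ⟩ + t * u p
  ⟨,shiftAt⟩ u v p t = trans (⟨,+⟩ u v (λ i → t * δ p i)) (+-congˡ (trans (⟨,*⟩ u (δ p) t) (*-congˡ (⟨,δ⟩ u p))))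

  zeroAt : ∀ {n} → Fin n → Vector n → Vector n
  zeroAt p v = shiftAt p (- v p) v

  zeroAt-self : ∀ {n} (p : Fin n) v → zeroAt p v p ≈ 0#
  zeroAt-self p v = trans (shiftAt-self p (- v p) v) (-‿inverseʳ (v p))

  shiftAt-zeroAt : ∀ {n} (p : Fin n) v → shiftAt p (v p) (zeroAt p v) ≋ v
  shiftAt-zeroAt p v i = begin
    (v i + - v p * δ p i) + v p * δ p i   ≈⟨ +-congʳ (+-congˡ (-‿distribˡ-* (v p) (δ p i))) ⟨
    (v i - v p * δ p i) + v p * δ p i     ≈⟨ [x-y]+y≈x (v i) _ ⟩
    v i                                   ∎

  record IsSubspace {n p} (V : Pred (Vector n) p) : Set (c ⊔ p) where
    field
      0∈ : V 0v
      +∈ : ∀ {u v} → V u → V v → V (λ i → u i + v i)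
      *∈ : ∀ a {v} → V v → V (λ i → a * v i)

  lincomb∈ : ∀ {n p d} {V : Pred (Vector n) p} → IsSubspace V →
    (a : Fin d → Carrier) (b : Fin d → Vector n) → (∀ j → V (b j)) → V (lincomb a b)
  lincomb∈ {d = zero}  V-sub a b b∈V = IsSubspace.0∈ V-sub
  lincomb∈ {d = suc d} V-sub a b b∈V = IsSubspace.+∈ V-sub (IsSubspace.*∈ V-sub (a zero) (b∈V zero))
    (lincomb∈ V-sub (λ j → a (suc j)) (λ j → b (suc j)) (λ j → b∈V (suc j)))

  Code-isSubspace : ∀ {n p} (C : Code n p) → IsSubspace (Code._∈C C)
  Code-isSubspace C = record { 0∈ = zero∈ ; +∈ = +-closed ; *∈ = *-closed }
    where open Code C

  record IsLinear {n m} (g : Vector n → Vector m) : Set (c ⊔ ℓ) where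
    field
      ≋-cong : ∀ {u v} → u ≋ v → g u ≋ g v
      +-homo : ∀ u v → g (λ i → u i + v i) ≋ (λ i → g u i + g v i)
      *-homo : ∀ a v → g (λ i → a * v i) ≋ (λ i → a * g v i)

  lincomb-homo : ∀ {n m d} {g : Vector n → Vector m} → IsLinear g →
    (a : Fin d → Carrier) (b : Fin d → Vector n) → g (lincomb a b) ≋ lincomb a (g ∘ b)
  lincomb-homo {d = zero} {g} g-lin a b i = begin
    g 0v i                ≈⟨ ≋-cong (λ _ → sym (zeroˡ 0#)) i ⟩
    g (λ k → 0# * 0# ) i  ≈⟨ *-homo 0# 0v i ⟩
    0# * g 0v i           ≈⟨ zeroˡ _ ⟩
    0#                    ∎
    where open IsLinear g-lin
  lincomb-homo {d = suc d} {g} g-lin a b i = begin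
    g (λ k → a zero * b zero k + lincomb a′ b′ k) i          ≈⟨ +-homo _ _ i ⟩
    g (λ k → a zero * b zero k) i + g (lincomb a′ b′) i      ≈⟨ +-cong (*-homo _ _ i) (lincomb-homo g-lin a′ b′ i) ⟩
    a zero * g (b zero) i + lincomb a′ (g ∘ b′) i            ∎
    where
    open IsLinear g-lin
    a′ = λ j → a (suc j)
    b′ = λ j → b (suc j)

  lincomb-isLinear : ∀ {n d} (b : Fin d → Vector n) → IsLinear (λ a → lincomb a b)
  lincomb-isLinear b = record
    { ≋-cong = λ a≋a′ i → ∑-cong (λ j → *-congʳ (a≋a′ j))
    ; +-homo = λ a a′ i → trans (∑-cong (λ j → distribʳ (b j i) (a j) (a′ j)))
                                (∑-distrib-+ (λ j → a j * b j i) (λ j → a′ j * b j i))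
    ; *-homo = λ x a i → trans (∑-cong (λ j → *-assoc x (a j) (b j i))) (sym (*-distribˡ-∑ x (λ j → a j * b j i)))
    }

  shiftAt-isLinear : ∀ {n} (p : Fin n) {t : Vector n → Carrier} →
    (∀ {u v} → u ≋ v → t u ≈ t v) → (∀ u v → t (λ i → u i + v i) ≈ t u + t v) →
    (∀ a v → t (λ i → a * v i) ≈ a * t v) → IsLinear (λ v → shiftAt p (t v) v)
  shiftAt-isLinear p {t} t-cong t-+ t-* = record
    { ≋-cong = λ u≋v i → +-cong (u≋v i) (*-congʳ (t-cong u≋v))
    ; +-homo = λ u v i → begin
        (u i + v i) + t (λ k → u k + v k) * δ p i   ≈⟨ +-congˡ (trans (*-congʳ (t-+ u v)) (distribʳ (δ p i) (t u) (t v))) ⟩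
        (u i + v i) + (t u * δ p i + t v * δ p i)   ≈⟨ +.interchange (u i) (v i) _ _ ⟩
        shiftAt p (t u) u i + shiftAt p (t v) v i   ∎
    ; *-homo = λ a v i → begin
        a * v i + t (λ k → a * v k) * δ p i         ≈⟨ +-congˡ (trans (*-congʳ (t-* a v)) (*-assoc a (t v) (δ p i))) ⟩
        a * v i + a * (t v * δ p i)                 ≈⟨ distribˡ a (v i) _ ⟨
        a * shiftAt p (t v) v i                     ∎
    }

  HasDim-resp : ∀ {n p q d} {V : Pred (Vector n) p} {W : Pred (Vector n) q} →
    (∀ {v} → V v → W v) → (∀ {v} → W v → V v) → HasDim V d → HasDim W d
  HasDim-resp V⊆W W⊆V (b , b∈V , b-indep , b-span) =
    b , (V⊆W ∘ b∈V) , b-indep , λ w w∈W → b-span w (W⊆V w∈W)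

  HasDim-iso : ∀ {n m p q d} {V : Pred (Vector n) p} {W : Pred (Vector m) q} {g : Vector n → Vector m} →
    IsSubspace V → IsLinear g → (∀ {v} → V v → W (g v)) → (∀ {v} → V v → g v ≋ 0v → v ≋ 0v) →
    (∀ {w} → W w → ∃ λ v → V v × w ≋ g v) → HasDim V d → HasDim W d
  HasDim-iso {W = W} {g = g} V-sub g-lin g∈W g-inj g-surj (b , b∈V , b-indep , b-span) =
    g ∘ b , g∈W ∘ b∈V , indep , span
    where
    indep : LinIndep (g ∘ b)
    indep a ga≋0 = b-indep a (g-inj (lincomb∈ V-sub a b b∈V) (λ i → trans (lincomb-homo g-lin a b i) (ga≋0 i)))
    span : ∀ w → W w → ∃ λ a → w ≋ lincomb a (g ∘ b)
    span w w∈W =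
      let (v , v∈V , w≋gv) = g-surj w∈W
          (a , v≋ba) = b-span v v∈V
      in a , λ i → trans (w≋gv i) (trans (IsLinear.≋-cong g-lin v≋ba i) (lincomb-homo g-lin a b i))

  HasDim-trivial : ∀ {n p} {V : Pred (Vector n) p} → (∀ {v} → V v → v ≋ 0v) → HasDim V 0
  HasDim-trivial V≋0 = (λ ()) , (λ ()) , (λ _ _ ()) , λ v v∈V → (λ ()) , V≋0 v∈V

  HasDim-trivial⇒0 : ∀ {n p d} {V : Pred (Vector n) p} → HasDim V d → (∀ {v} → V v → v ≋ 0v) → d ≡ 0
  HasDim-trivial⇒0 {d = zero}  _ _ = ≡.refl
  HasDim-trivial⇒0 {d = suc d} (b , b∈V , b-indep , _) V≋0 =
    ⊥-elim (1≉0 (trans (sym (δ-diag {suc d} zero)) (b-indep (δ zero) b₀≋0 zero)))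
    where
    b₀≋0 : lincomb (δ zero) b ≋ 0v
    b₀≋0 i = begin
      1# * b zero i + ∑ (λ j → 0# * b (suc j) i) ≈⟨ +-cong (*-identityˡ _) (∑-zero (λ j → zeroˡ (b (suc j) i))) ⟩
      b zero i + 0#                                ≈⟨ +-identityʳ _ ⟩
      b zero i                                     ≈⟨ V≋0 (b∈V zero) i ⟩
      0#                                           ∎

  HasDim-extend : ∀ {n p q d} {V : Pred (Vector n) p} {V′ : Pred (Vector n) q} (p : Fin n) →
    (∀ {v} → V v → V′ (zeroAt p v)) → (∀ {v} → V′ v → V v) → V (δ p) → (∀ {v} → V′ v → v p ≈ 0#) →
    HasDim V′ d → HasDim V (suc d)
  HasDim-extend {n} {d = d} {V} p zeroAt∈V′ V′⊆V δ∈V V′-vanish (b , b∈V′ , b-indep , b-span) =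
    b₊ , b₊∈V , b₊-indep , b₊-span
    where
    b₊ : Fin (suc d) → Vector n
    b₊ zero    = δ p
    b₊ (suc j) = b j
    b₊∈V : ∀ j → V (b₊ j)
    b₊∈V zero    = δ∈V
    b₊∈V (suc j) = V′⊆V (b∈V′ j)
    b₊-indep : LinIndep b₊
    b₊-indep a a·b₊≋0 = a≈0
      where
      rest = lincomb (λ j → a (suc j)) b
      rest-p : rest p ≈ 0#
      rest-p = ∑-zero (λ j → trans (*-congˡ (V′-vanish (b∈V′ j))) (zeroʳ _))
      a₀≈0 : a zero ≈ 0#
      a₀≈0 = begin
        a zero                    ≈⟨ *-identityʳ _ ⟨
        a zero * 1#               ≈⟨ *-congˡ (δ-diag p) ⟨
        a zero * δ p p            ≈⟨ +-identityʳ _ ⟨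
        a zero * δ p p + 0#       ≈⟨ +-congˡ rest-p ⟨
        a zero * δ p p + rest p   ≈⟨ a·b₊≋0 p ⟩
        0#                        ∎
      rest≋0 : rest ≋ 0v
      rest≋0 i = begin
        rest i                    ≈⟨ +-identityˡ _ ⟨
        0# + rest i               ≈⟨ +-congʳ (trans (*-congʳ a₀≈0) (zeroˡ (δ p i))) ⟨
        a zero * δ p i + rest i   ≈⟨ a·b₊≋0 i ⟩
        0#                        ∎
      a≈0 : ∀ j → a j ≈ 0#
      a≈0 zero    = a₀≈0
      a≈0 (suc j) = b-indep (λ j → a (suc j)) rest≋0 j
    b₊-span : ∀ v → V v → ∃ λ a → v ≋ lincomb a b₊
    b₊-span v v∈V = a₊ , λ i → trans (sym (shiftAt-zeroAt p v i)) (trans (+-comm _ _) (+-congˡ (zeroAt≋ba i)))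
      where
      a = proj₁ (b-span (zeroAt p v) (zeroAt∈V′ v∈V))
      zeroAt≋ba = proj₂ (b-span (zeroAt p v) (zeroAt∈V′ v∈V))
      a₊ : Fin (suc d) → Carrier
      a₊ zero    = v p
      a₊ (suc j) = a j

  Matrix : ℕ → ℕ → Set c
  Matrix m n = Fin m → Vector n

  _ᵀ : ∀ {m n} → Matrix m n → Matrix n m
  (A ᵀ) i j = A j i

  SupportedIn : ∀ {n} → Subset n → Pred (Vector n) ℓ
  SupportedIn S v = ∀ i → i ∉ S → v i ≈ 0#

  -- The kernel of the R × S block of A, extended by zero to a subspace of 𝔽ⁿ.
  Ker : ∀ {m n} → Matrix m n → Subset m → Subset n → Pred (Vector n) ℓ
  Ker A R S v = SupportedIn S v × (∀ j → j ∈ R → ⟨ A j , v ⟩ ≈ 0#)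

  Ker-isSubspace : ∀ {m n} (A : Matrix m n) R S → IsSubspace (Ker A R S)
  Ker-isSubspace A R S = record
    { 0∈ = (λ _ _ → refl) , λ j _ → ⟨,0⟩ (A j)
    ; +∈ = λ {u} {v} (u-supp , Au≈0) (v-supp , Av≈0) →
             (λ i i∉S → trans (+-cong (u-supp i i∉S) (v-supp i i∉S)) (+-identityʳ 0#)) ,
             λ j j∈R → trans (⟨,+⟩ (A j) u v) (trans (+-cong (Au≈0 j j∈R) (Av≈0 j j∈R)) (+-identityʳ 0#))
    ; *∈ = λ a {v} (v-supp , Av≈0) →
             (λ i i∉S → trans (*-congˡ (v-supp i i∉S)) (zeroʳ a)) ,
             λ j j∈R → trans (⟨,*⟩ (A j) v a) (trans (*-congˡ (Av≈0 j j∈R)) (zeroʳ a))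
    }

  Ker-cong : ∀ {m n} {A B : Matrix m n} {R S v} → (∀ j → A j ≋ B j) → Ker A R S v → Ker B R S v
  Ker-cong A≋B (v-supp , Av≈0) = v-supp , λ j j∈R → trans (⟨,⟩-cong (λ i → sym (A≋B j i)) (λ _ → refl)) (Av≈0 j j∈R)

  SupportedIn-remove : ∀ {n} {S : Subset n} {p v} → SupportedIn (S ∖ p) v → SupportedIn S v
  SupportedIn-remove {S = S} {p} v-supp i i∉S = v-supp i (i∉S ∘ p─q⊆p S ⁅ p ⁆)

  δ-supportedIn : ∀ {n} {S : Subset n} {p} → p ∈ S → SupportedIn S (δ p)
  δ-supportedIn p∈S i i∉S = δ-off (λ p≡i → i∉S (≡.subst (_∈ _) p≡i p∈S))

  zeroAt-supportedIn : ∀ {n} {S : Subset n} {p v} → SupportedIn S v → SupportedIn (S ∖ p) (zeroAt p v)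
  zeroAt-supportedIn {p = p} {v} v-supp i i∉S∖p with p Fin.≟ i
  ... | yes ≡.refl = zeroAt-self p v
  ... | no p≢i     = trans (shiftAt-off (- v p) v p≢i) (v-supp i (i∉S∖p ∘ λ i∈S → x∈p∧x≢y⇒x∈p-y i∈S (p≢i ∘ ≡.sym)))

  module _ {m n} (A : Matrix m n) (R : Subset m) {S : Subset n} {p : Fin n}
           (p∈S : p ∈ S) (column-p≈0 : ∀ j → j ∈ R → A j p ≈ 0#) where

    Ker-zeroColumn : ∀ {d} → HasDim (Ker A R (S ∖ p)) d → HasDim (Ker A R S) (suc d)
    Ker-zeroColumn = HasDim-extend p zeroAt∈ (λ (v-supp , Av≈0) → SupportedIn-remove v-supp , Av≈0)
      (δ-supportedIn p∈S , λ j j∈R → trans (⟨,δ⟩ (A j) p) (column-p≈0 j j∈R))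
      (λ (v-supp , _) → v-supp p (x∉p∖x p S))
      where
      zeroAt∈ : ∀ {v} → Ker A R S v → Ker A R (S ∖ p) (zeroAt p v)
      zeroAt∈ {v} (v-supp , Av≈0) = zeroAt-supportedIn v-supp , λ j j∈R → begin
        ⟨ A j , zeroAt p v ⟩        ≈⟨ ⟨,shiftAt⟩ (A j) v p (- v p) ⟩
        ⟨ A j , v ⟩ + - v p * A j p ≈⟨ +-cong (Av≈0 j j∈R) (trans (*-congˡ (column-p≈0 j j∈R)) (zeroʳ _)) ⟩
        0# + 0#                     ≈⟨ +-identityʳ 0# ⟩
        0#                          ∎

    Ker-zeroColumnᵀ : ∀ {d} → HasDim (Ker (A ᵀ) (S ∖ p) R) d → HasDim (Ker (A ᵀ) S R) d
    Ker-zeroColumnᵀ = HasDim-resp (λ (w-supp , Aᵀw≈0) → w-supp , orth w-supp Aᵀw≈0)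
                                  (λ (w-supp , Aᵀw≈0) → w-supp , λ i i∈S∖p → Aᵀw≈0 i (p─q⊆p S ⁅ p ⁆ i∈S∖p))
      where
      orth : ∀ {w} → SupportedIn R w → (∀ i → i ∈ S ∖ p → ⟨ (A ᵀ) i , w ⟩ ≈ 0#) → ∀ i → i ∈ S → ⟨ (A ᵀ) i , w ⟩ ≈ 0#
      orth {w} w-supp Aᵀw≈0 i i∈S with p Fin.≟ i
      ... | yes ≡.refl = ∑-zero term≈0
        where
        term≈0 : ∀ j → A j p * w j ≈ 0#
        term≈0 j with j ∈? R
        ... | yes j∈R = trans (*-congʳ (column-p≈0 j j∈R)) (zeroˡ (w j))
        ... | no j∉R  = trans (*-congˡ (w-supp j j∉R)) (zeroʳ (A j p))
      ... | no p≢i     = Aᵀw≈0 i (x∈p∧x≢y⇒x∈p-y i∈S (p≢i ∘ ≡.sym))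

  eliminate : ∀ {m n} → Matrix m n → Fin m → Fin n → Carrier → Matrix m n
  eliminate A q p y j i = A j i + - (A j p * y) * A q i

  eliminate-ᵀ : ∀ {m n} (A : Matrix m n) q p y j → (eliminate A q p y ᵀ) j ≋ eliminate (A ᵀ) p q y j
  eliminate-ᵀ A q p y i j = +-congˡ (-x*y-cong (*.xy∙z≈zy∙x (A j p) y (A q i)))

  ⟨eliminate,⟩ : ∀ {m n} (A : Matrix m n) q p y j w →
    ⟨ eliminate A q p y j , w ⟩ ≈ ⟨ A j , w ⟩ + - (A j p * y) * ⟨ A q , w ⟩
  ⟨eliminate,⟩ A q p y j w = begin
    ⟨ eliminate A q p y j , w ⟩                                 ≈⟨ ⟨,⟩-comm _ w ⟩
    ⟨ w , (λ i → A j i + - (A j p * y) * A q i) ⟩               ≈⟨ ⟨,+⟩ w (A j) (λ i → - (A j p * y) * A q i) ⟩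
    ⟨ w , A j ⟩ + ⟨ w , (λ i → - (A j p * y) * A q i) ⟩         ≈⟨ +-cong (⟨,⟩-comm w (A j)) (⟨,*⟩ w (A q) _) ⟩
    ⟨ A j , w ⟩ + - (A j p * y) * ⟨ w , A q ⟩                   ≈⟨ +-congˡ (*-congˡ (⟨,⟩-comm w (A q))) ⟩
    ⟨ A j , w ⟩ + - (A j p * y) * ⟨ A q , w ⟩                   ∎

  -- Eliminating with the pivot A q p leaves row q of A′ zero; adding back to w the multiple of δ p
  -- that restores row q identifies the kernel of the (R ∖ q) × (S ∖ p) block of A′ with that of the
  -- R × S block of A.
  module _ {m n} (A : Matrix m n) {R : Subset m} {S : Subset n} {q : Fin m} {p : Fin n} {y : Carrier}
           (q∈R : q ∈ R) (p∈S : p ∈ S) (pivot : A q p * y ≈ 1#) where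

    private
      A′ : Matrix m n
      A′ = eliminate A q p y

      A′-row-q≋0 : A′ q ≋ 0v
      A′-row-q≋0 i = begin
        A q i + - (A q p * y) * A q i ≈⟨ +-congˡ (*-congʳ (-‿cong pivot)) ⟩
        A q i + - 1# * A q i          ≈⟨ +-congˡ (-1*x≈-x (A q i)) ⟩
        A q i + - A q i               ≈⟨ -‿inverseʳ (A q i) ⟩
        0#                            ∎

      t : Vector n → Carrier
      t w = - (y * ⟨ A q , w ⟩)

      g : Vector n → Vector n
      g w = shiftAt p (t w) w

      ⟨A,g⟩≈⟨A′,⟩ : ∀ j w → ⟨ A j , g w ⟩ ≈ ⟨ A′ j , w ⟩
      ⟨A,g⟩≈⟨A′,⟩ j w = begin
        ⟨ A j , g w ⟩                              ≈⟨ ⟨,shiftAt⟩ (A j) w p (t w) ⟩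
        ⟨ A j , w ⟩ + t w * A j p                   ≈⟨ +-congˡ (-x*y-cong (*.xy∙z≈zx∙y y _ (A j p))) ⟩
        ⟨ A j , w ⟩ + - (A j p * y) * ⟨ A q , w ⟩   ≈⟨ ⟨eliminate,⟩ A q p y j w ⟨
        ⟨ A′ j , w ⟩                               ∎

      g-isLinear : IsLinear g
      g-isLinear = shiftAt-isLinear p
        (λ u≋v → -‿cong (*-congˡ (⟨,⟩-cong (λ _ → refl) u≋v)))
        (λ u v → trans (-‿cong (trans (*-congˡ (⟨,+⟩ (A q) u v)) (distribˡ y _ _))) (sym (-‿+-comm _ _)))
        (λ a v → trans (-‿cong (trans (*-congˡ (⟨,*⟩ (A q) v a)) (x∙yz≈y∙xz y a _))) (-‿distribʳ-* a _))

      g∈Ker : ∀ {w} → Ker A′ (R ∖ q) (S ∖ p) w → Ker A R S (g w)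
      g∈Ker {w} (w-supp , A′w≈0) = supp , orth
        where
        supp : SupportedIn S (g w)
        supp i i∉S = trans (shiftAt-off (t w) w (λ p≡i → i∉S (≡.subst (_∈ S) p≡i p∈S)))
                           (SupportedIn-remove w-supp i i∉S)
        orth : ∀ j → j ∈ R → ⟨ A j , g w ⟩ ≈ 0#
        orth j j∈R with q Fin.≟ j
        ... | yes ≡.refl = trans (⟨A,g⟩≈⟨A′,⟩ q w) (trans (⟨,⟩-cong A′-row-q≋0 (λ _ → refl)) (∑-zero (λ i → zeroˡ (w i))))
        ... | no q≢j     = trans (⟨A,g⟩≈⟨A′,⟩ j w) (A′w≈0 j (x∈p∧x≢y⇒x∈p-y j∈R (q≢j ∘ ≡.sym)))

      g-injective : ∀ {w} → Ker A′ (R ∖ q) (S ∖ p) w → g w ≋ 0v → w ≋ 0v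
      g-injective {w} (w-supp , _) gw≋0 i with p Fin.≟ i
      ... | yes ≡.refl = w-supp p (x∉p∖x p S)
      ... | no p≢i     = trans (sym (shiftAt-off (t w) w p≢i)) (gw≋0 i)

      g-surjective : ∀ {v} → Ker A R S v → ∃ λ w → Ker A′ (R ∖ q) (S ∖ p) w × v ≋ g w
      g-surjective {v} (v-supp , Av≈0) = w , (zeroAt-supportedIn v-supp , orth) , v≋gw
        where
        w = zeroAt p v
        ⟨A,w⟩ : ∀ j → j ∈ R → ⟨ A j , w ⟩ ≈ - v p * A j p
        ⟨A,w⟩ j j∈R = trans (⟨,shiftAt⟩ (A j) v p (- v p)) (trans (+-congʳ (Av≈0 j j∈R)) (+-identityˡ _))
        tw≈vp : t w ≈ v p
        tw≈vp = begin
          - (y * ⟨ A q , w ⟩)        ≈⟨ -‿cong (*-congˡ (⟨A,w⟩ q q∈R)) ⟩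
          - (y * (- v p * A q p))    ≈⟨ -‿cong (*.x∙yz≈y∙zx y (- v p) (A q p)) ⟩
          - (- v p * (A q p * y))    ≈⟨ -‿cong (trans (*-congˡ pivot) (*-identityʳ _)) ⟩
          - - v p                    ≈⟨ -‿involutive (v p) ⟩
          v p                        ∎
        v≋gw : v ≋ g w
        v≋gw i = sym (trans (+-congˡ (*-congʳ tw≈vp)) (shiftAt-zeroAt p v i))
        orth : ∀ j → j ∈ R ∖ q → ⟨ A′ j , w ⟩ ≈ 0#
        orth j j∈R∖q = trans (sym (⟨A,g⟩≈⟨A′,⟩ j w))
          (trans (⟨,⟩-cong (λ _ → refl) (sym ∘ v≋gw)) (Av≈0 j (p─q⊆p R ⁅ q ⁆ j∈R∖q)))

    Ker-pivot : ∀ {d} → HasDim (Ker (eliminate A q p y) (R ∖ q) (S ∖ p)) d → HasDim (Ker A R S) d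
    Ker-pivot = HasDim-iso (Ker-isSubspace A′ (R ∖ q) (S ∖ p)) g-isLinear g∈Ker g-injective g-surjective

  -- Rank identity, by Gaussian elimination

  ¬¬-zeroColumn⊎pivot : ∀ {m n} (A : Matrix m n) R p →
    DoubleNegation ((∀ j → j ∈ R → A j p ≈ 0#) ⊎ ∃ λ j → j ∈ R × ¬ A j p ≈ 0#)
  ¬¬-zeroColumn⊎pivot A R p = ¬¬-map (⊎.map₂ pivotIn) (¬¬-∀⊎∃¬ (λ j → j ∈ R → A j p ≈ 0#))
    where
    pivotIn : (∃ λ j → ¬ (j ∈ R → A j p ≈ 0#)) → ∃ λ j → j ∈ R × ¬ A j p ≈ 0#
    pivotIn (j , ¬Qj) with j ∈? R
    ... | yes j∈R = j , j∈R , λ Ajp≈0 → ¬Qj (λ _ → Ajp≈0)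
    ... | no j∉R  = ⊥-elim (¬Qj (λ j∈R → contradiction j∈R j∉R))

  -- Rank–nullity for the R × S block and its transpose: d₁ = #S − r and d₂ = #R − r for its rank r.
  KerDimensions : ∀ {m n} → Matrix m n → Subset m → Subset n → Set (c ⊔ ℓ)
  KerDimensions A R S = ∃₂ λ d₁ d₂ →
    HasDim (Ker A R S) d₁ × HasDim (Ker (A ᵀ) S R) d₂ × d₁ ℕ.+ ∣ R ∣ ≡ ∣ S ∣ ℕ.+ d₂

  KerDimensions-ᵀ : ∀ {m n} {A : Matrix m n} {R S} → KerDimensions (A ᵀ) S R → KerDimensions A R S
  KerDimensions-ᵀ {R = R} {S} (d₁ , d₂ , dim₁ , dim₂ , eq) =
    d₂ , d₁ , dim₂ , dim₁ , ≡.trans (ℕₚ.+-comm d₂ ∣ R ∣) (≡.trans (≡.sym eq) (ℕₚ.+-comm d₁ ∣ S ∣))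

  KerDimensions-empty : ∀ {m n} (A : Matrix m n) {R S} → Empty R → Empty S → KerDimensions A R S
  KerDimensions-empty {m} {n} A {R} {S} ∅R ∅S = 0 , 0 ,
    HasDim-trivial (λ (v-supp , _) i → v-supp i (λ i∈S → ∅S (i , i∈S))) ,
    HasDim-trivial (λ (w-supp , _) j → w-supp j (λ j∈R → ∅R (j , j∈R))) ,
    ≡.trans (cong ∣_∣ (Empty-unique ∅R)) (≡.trans (∣⊥∣≡0 m) (≡.sym (≡.trans (ℕₚ.+-identityʳ ∣ S ∣)
      (≡.trans (cong ∣_∣ (Empty-unique ∅S)) (∣⊥∣≡0 n)))))

  private
    KerDimensionsUpTo : ℕ → Set (c ⊔ ℓ)
    KerDimensionsUpTo f = ∀ {m n} (A : Matrix m n) R S → ∣ R ∣ ℕ.+ ∣ S ∣ ≤ f → DoubleNegation (KerDimensions A R S)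

    ¬¬-kerDimensions-column : ∀ {f} → (∀ {f′} → f′ < f → KerDimensionsUpTo f′) →
      ∀ {m n} (A : Matrix m n) R S {p} → p ∈ S → ∣ R ∣ ℕ.+ ∣ S ∣ ≤ f → DoubleNegation (KerDimensions A R S)
    ¬¬-kerDimensions-column rec A R S {p} p∈S size≤f = ¬¬-zeroColumn⊎pivot A R p >>= λ
      { (inj₁ column≈0) →
          rec (ℕₚ.<-≤-trans (ℕₚ.+-monoʳ-< ∣ R ∣ ∣S∖p∣<∣S∣) size≤f) A R (S ∖ p) ℕₚ.≤-refl >>= λ (d₁ , d₂ , dim₁ , dim₂ , eq) →
          pure (suc d₁ , d₂ , Ker-zeroColumn A R p∈S column≈0 dim₁ , Ker-zeroColumnᵀ A R p∈S column≈0 dim₂ ,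
                ≡.trans (cong suc eq) (cong (ℕ._+ d₂) suc∣S∖p∣≡∣S∣))
      ; (inj₂ (q , q∈R , Aqp≉0)) → let (y , pivot) = inverse (A q p) Aqp≉0 in
          rec (ℕₚ.<-≤-trans (ℕₚ.+-mono-≤-< (∣p─q∣≤∣p∣ R ⁅ q ⁆) ∣S∖p∣<∣S∣) size≤f) (eliminate A q p y) (R ∖ q) (S ∖ p) ℕₚ.≤-refl
            >>= λ (d₁ , d₂ , dim₁ , dim₂ , eq) →
          pure (d₁ , d₂ , Ker-pivot A q∈R p∈S pivot dim₁ ,
                Ker-pivot (A ᵀ) p∈S q∈R pivot
                  (HasDim-resp (Ker-cong (eliminate-ᵀ A q p y)) (Ker-cong (λ j i → sym (eliminate-ᵀ A q p y j i))) dim₂) ,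
                ∣∖∣-balance q∈R p∈S eq) }
      where
      suc∣S∖p∣≡∣S∣ = suc∣p∖x∣≡∣p∣ p∈S
      ∣S∖p∣<∣S∣ = x∈p⇒∣p-x∣<∣p∣ p∈S

  ¬¬-kerDimensions : ∀ {m n} (A : Matrix m n) R S → DoubleNegation (KerDimensions A R S)
  ¬¬-kerDimensions A R S = <-rec KerDimensionsUpTo step _ A R S ℕₚ.≤-refl
    where
    step : ∀ f → (∀ {f′} → f′ < f → KerDimensionsUpTo f′) → KerDimensionsUpTo f
    step f rec A R S size≤f with nonempty? S | nonempty? R
    ... | yes (p , p∈S) | _             = ¬¬-kerDimensions-column rec A R S p∈S size≤f
    ... | no ∅S         | yes (q , q∈R) = ¬¬-map KerDimensions-ᵀ
          (¬¬-kerDimensions-column rec (A ᵀ) S R q∈R (≡.subst (_≤ f) (ℕₚ.+-comm ∣ R ∣ ∣ S ∣) size≤f))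
    ... | no ∅S         | no ∅R         = pure (KerDimensions-empty A ∅R ∅S)

  ¬¬-HasDim-≤ : ∀ {n p d d′} {V : Pred (Vector n) p} → HasDim V d → HasDim V d′ → DoubleNegation (d ≤ d′)
  ¬¬-HasDim-≤ {d = d} {d′} (b , b∈V , b-indep , _) (b′ , _ , _ , b′-span) =
    ¬¬-map d≤d′ (¬¬-kerDimensions coords ⊤ ⊤)
    where
    -- the coordinates of the first basis in the second: a matrix whose transpose has trivial kernel
    coords : Matrix d d′
    coords i = proj₁ (b′-span (b i) (b∈V i))
    Kerᵀ-trivial : ∀ {a} → Ker (coords ᵀ) ⊤ ⊤ a → a ≋ 0v
    Kerᵀ-trivial {a} (_ , coordsᵀa≈0) = b-indep a λ k → begin
      lincomb a b k                               ≈⟨ ∑-cong (λ i → *-congˡ (proj₂ (b′-span (b i) (b∈V i)) k)) ⟩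
      ⟨ a , (λ i → ⟨ coords i , (b′ ᵀ) k ⟩) ⟩     ≈⟨ ⟨lincomb,⟩ a coords ((b′ ᵀ) k) ⟨
      ⟨ lincomb a coords , (b′ ᵀ) k ⟩             ≈⟨ ∑-zero (λ j → trans (*-congʳ (trans (⟨,⟩-comm a ((coords ᵀ) j))
                                                                               (coordsᵀa≈0 j ∈⊤))) (zeroˡ _)) ⟩
      0#                                          ∎
    d≤d′ : KerDimensions coords ⊤ ⊤ → d ≤ d′
    d≤d′ (d₁ , d₂ , _ , dim₂ , eq) rewrite HasDim-trivial⇒0 dim₂ Kerᵀ-trivial | ∣⊤∣≡n d | ∣⊤∣≡n d′ | ℕₚ.+-identityʳ d′ =
      ≡.subst (d ≤_) eq (ℕₚ.m≤n+m d d₁)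

  HasDim-unique : ∀ {n p d d′} {V : Pred (Vector n) p} → HasDim V d → HasDim V d′ → d ≡ d′
  HasDim-unique dim dim′ = decidable-stable (_ ℕ.≟ _)
    (¬¬-HasDim-≤ dim dim′ >>= λ d≤d′ → ¬¬-HasDim-≤ dim′ dim >>= λ d′≤d → pure (ℕₚ.≤-antisym d≤d′ d′≤d))

  dim-dual-restrict : ∀ {n p k} (C : Code n p) → HasDim (Code._∈C C) k → ∀ J {d d⊥} →
    HasDim (Restrict (Code._∈C C) (∁ J)) d → HasDim (Restrict (Dual C) J) d⊥ → d⊥ ℕ.+ k ≡ ∣ ∁ J ∣ ℕ.+ d
  dim-dual-restrict {k = k} C (b , b∈C , b-indep , b-span) J {d} {d⊥} dim dim⊥ =
    decidable-stable (_ ℕ.≟ _) (¬¬-map dims (¬¬-kerDimensions b ⊤ (∁ J)))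
    where
    open Code C using (_∈C)
    Ker⇒Dual : ∀ {v} → Ker b ⊤ (∁ J) v → Restrict (Dual C) J v
    Ker⇒Dual {v} (v-supp , bv≈0) = (λ u u∈C → let (a , u≋ba) = b-span u u∈C in begin
        ⟨ u , v ⟩                     ≈⟨ ⟨,⟩-cong u≋ba (λ _ → refl) ⟩
        ⟨ lincomb a b , v ⟩           ≈⟨ ⟨lincomb,⟩ a b v ⟩
        ∑ (λ j → a j * ⟨ b j , v ⟩)   ≈⟨ ∑-zero (λ j → trans (*-congˡ (bv≈0 j ∈⊤)) (zeroʳ (a j))) ⟩
        0#                            ∎) ,
      λ i i∈J → v-supp i (x∈p⇒x∉∁p i∈J)
    Dual⇒Ker : ∀ {v} → Restrict (Dual C) J v → Ker b ⊤ (∁ J) v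
    Dual⇒Ker (v∈C⊥ , v-vanish) = (λ i i∉∁J → v-vanish i (x∉∁p⇒x∈p i∉∁J)) , λ j _ → v∈C⊥ (b j) (b∈C j)
    lincomb∈C : ∀ {a} → Ker (b ᵀ) (∁ J) ⊤ a → Restrict _∈C (∁ J) (lincomb a b)
    lincomb∈C {a} (_ , bᵀa≈0) = lincomb∈ (Code-isSubspace C) a b b∈C ,
      λ i i∈∁J → trans (⟨,⟩-comm a ((b ᵀ) i)) (bᵀa≈0 i i∈∁J)
    lincomb-surjective : ∀ {w} → Restrict _∈C (∁ J) w → ∃ λ a → Ker (b ᵀ) (∁ J) ⊤ a × w ≋ lincomb a b
    lincomb-surjective {w} (w∈C , w-vanish) = let (a , w≋ba) = b-span w w∈C in
      a , ((λ j j∉⊤ → contradiction ∈⊤ j∉⊤) ,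
           λ i i∈∁J → trans (⟨,⟩-comm ((b ᵀ) i) a) (trans (sym (w≋ba i)) (w-vanish i i∈∁J))) , w≋ba
    dims : KerDimensions b ⊤ (∁ J) → d⊥ ℕ.+ k ≡ ∣ ∁ J ∣ ℕ.+ d
    dims (d₁ , d₂ , dim₁ , dim₂ , eq) =
      ≡.trans (cong₂ ℕ._+_ d⊥≡d₁ (≡.sym (∣⊤∣≡n k))) (≡.trans eq (cong (∣ ∁ J ∣ ℕ.+_) d₂≡d))
      where
      d⊥≡d₁ = HasDim-unique dim⊥ (HasDim-resp Ker⇒Dual Dual⇒Ker dim₁)
      d₂≡d = HasDim-unique (HasDim-iso (Ker-isSubspace (b ᵀ) (∁ J) ⊤) (lincomb-isLinear b)
                                       lincomb∈C (λ _ → b-indep _) lincomb-surjective dim₂) dim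

-- Mirrored polygons

import Data.Integer as ℤ
import Data.Integer.Properties as ℤₚ
open import Data.Rational as ℚ using (ℚ; mkℚ; _+_; _-_; _*_; -_; 0ℚ; 1ℚ)
import Data.Rational.Properties as ℚₚ
open import Data.Rational.Solver using (module +-*-Solver)
import Data.Nat.Coprimality as Coprime
open import Data.Fin.Subset.Properties using (∪-∩-booleanAlgebra; p⊂q⇒∁p⊃∁q)
open import Data.Fin.Subset using (_⊂_)
import Algebra.Lattice.Properties.BooleanAlgebra as BooleanAlgebraₚ
open import Algebra.Properties.Group ℚₚ.+-0-group using () renaming (∙-cancelʳ to +-cancelʳ)

ℕ→ℚ-+ : ∀ a b → ℕ→ℚ (a ℕ.+ b) ≡ ℕ→ℚ a + ℕ→ℚ b
ℕ→ℚ-+ a b = ≡.trans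
  (ℚₚ./-cong {p₂ = ℤ.+ a ℤ.* ℤ.+ 1 ℤ.+ ℤ.+ b ℤ.* ℤ.+ 1} {q₂ = 1}
    (≡.trans (ℤₚ.pos-+ a b) (≡.sym (cong₂ ℤ._+_ (ℤₚ.*-identityʳ (ℤ.+ a)) (ℤₚ.*-identityʳ (ℤ.+ b))))) ≡.refl)
  (cong₂ _+_ (≡.sym (ℕ→ℚ≡mkℚ a)) (≡.sym (ℕ→ℚ≡mkℚ b)))
  where
  ℕ→ℚ≡mkℚ : ∀ m → ℕ→ℚ m ≡ mkℚ (ℤ.+ m) 0 (Coprime.sym (Coprime.1-coprimeTo m))
  ℕ→ℚ≡mkℚ m = ℚₚ.↥p/↧p≡p (mkℚ (ℤ.+ m) 0 (Coprime.sym (Coprime.1-coprimeTo m)))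

x-[x-y]≡y : ∀ x y → x - (x - y) ≡ y
x-[x-y]≡y = solve 2 (λ x y → x :- (x :- y) := y) ≡.refl
  where open +-*-Solver

-‿antimono-≤ : ∀ {a b} c → a ℚ.≤ b → c - b ℚ.≤ c - a
-‿antimono-≤ c a≤b = ℚₚ.+-monoʳ-≤ c (ℚₚ.neg-antimono-≤ a≤b)

-‿antimono-< : ∀ {a b} c → a ℚ.< b → c - b ℚ.< c - a
-‿antimono-< c a<b = ℚₚ.+-monoʳ-< c (ℚₚ.neg-antimono-< a<b)

module _ (n : ℕ) where
  open +-*-Solver

  open BooleanAlgebraₚ (∪-∩-booleanAlgebra n) using () renaming (¬-involutive to ∁-involutive; ¬⊤≈⊥ to ∁⊤≡⊥; ¬⊥≈⊤ to ∁⊥≡⊤)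

  private
    N : ℚ
    N = ℕ→ℚ n

  mirror : ℚ → (ℚ → ℚ) → ℚ → ℚ
  mirror K P x = ((P (N - x) + N) - x) - K

  mirror-involutive : ∀ K P x → mirror (N - K) (mirror K P) x ≡ P x
  mirror-involutive K P x = ≡.trans
    (solve 4 (λ p N x K → ((((p :+ N) :- (N :- x)) :- K) :+ N) :- x :- (N :- K) := p) ≡.refl (P (N - (N - x))) N x K)
    (cong P (x-[x-y]≡y N x))

  InRange-reflect : ∀ {x} → InRange n x → InRange n (N - x)
  InRange-reflect (0≤x , x≤N) = ≡.subst (ℚ._≤ N - _) (ℚₚ.+-inverseʳ N) (-‿antimono-≤ N x≤N)
                              , ≡.subst (N - _ ℚ.≤_) (ℚₚ.+-identityʳ N) (-‿antimono-≤ N 0≤x)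

  mirror-mono : ∀ K {P Q} → (∀ x → InRange n x → P x ℚ.≤ Q x) → ∀ x → InRange n x → mirror K P x ℚ.≤ mirror K Q x
  mirror-mono K P≤Q x x∈[0,N] =
    ℚₚ.+-monoˡ-≤ (- K) (ℚₚ.+-monoˡ-≤ (- x) (ℚₚ.+-monoˡ-≤ N (P≤Q (N - x) (InRange-reflect x∈[0,N]))))

  ConcaveOn-mirror : ∀ K {P} → ConcaveOn n P → ConcaveOn n (mirror K P)
  ConcaveOn-mirror K {P} P-concave x y t x∈[0,N] y∈[0,N] 0≤t t≤1 = begin
    t * mirror K P x + (1ℚ - t) * mirror K P y
      ≡⟨ solve 7 (λ t px py x y N K →
           t :* (((px :+ N) :- x) :- K) :+ (con 1ℚ :- t) :* (((py :+ N) :- y) :- K) :=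
           (t :* px :+ (con 1ℚ :- t) :* py) :+ ((N :- (t :* x :+ (con 1ℚ :- t) :* y)) :- K))
         ≡.refl t (P (N - x)) (P (N - y)) x y N K ⟩
    (t * P (N - x) + (1ℚ - t) * P (N - y)) + ((N - z) - K)
      ≤⟨ ℚₚ.+-monoˡ-≤ ((N - z) - K) (P-concave (N - x) (N - y) t (InRange-reflect x∈[0,N]) (InRange-reflect y∈[0,N]) 0≤t t≤1) ⟩
    P (t * (N - x) + (1ℚ - t) * (N - y)) + ((N - z) - K)
      ≡⟨ cong (λ w → P w + ((N - z) - K))
           (solve 4 (λ t N x y → t :* (N :- x) :+ (con 1ℚ :- t) :* (N :- y) := N :- (t :* x :+ (con 1ℚ :- t) :* y))
              ≡.refl t N x y) ⟩
    P (N - z) + ((N - z) - K)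
      ≡⟨ solve 4 (λ p N z K → p :+ ((N :- z) :- K) := ((p :+ N) :- z) :- K) ≡.refl (P (N - z)) N z K ⟩
    mirror K P z ∎
    where
    open ℚₚ.≤-Reasoning
    z = t * x + (1ℚ - t) * y

  IsVertex-mirror : ∀ K {P z} → IsVertex n P z → IsVertex n (mirror K P) (N - z)
  IsVertex-mirror K {P} {z} (z∈[0,N] , P-strict) = InRange-reflect z∈[0,N] , strict
    where
    strict : ∀ a′ b′ → 0ℚ ℚ.≤ a′ → a′ ℚ.< N - z → N - z ℚ.< b′ → b′ ℚ.≤ N →
      (b′ - (N - z)) * mirror K P a′ + ((N - z) - a′) * mirror K P b′ ℚ.< (b′ - a′) * mirror K P (N - z)
    strict a′ b′ 0≤a′ a′<N-z N-z<b′ b′≤N = begin-strict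
      (b′ - (N - z)) * mirror K P a′ + ((N - z) - a′) * mirror K P b′
        ≡⟨ solve 7 (λ pa pb a′ b′ z N K →
             (b′ :- (N :- z)) :* (((pb :+ N) :- a′) :- K) :+ ((N :- z) :- a′) :* (((pa :+ N) :- b′) :- K) :=
             (((N :- a′) :- z) :* pa :+ (z :- (N :- b′)) :* pb) :+ (b′ :- a′) :* ((N :- (N :- z)) :- K))
           ≡.refl (P a) (P b) a′ b′ z N K ⟩
      ((b - z) * P a + (z - a) * P b) + E
        <⟨ ℚₚ.+-monoˡ-< E (P-strict a b 0≤a a<z z<b b≤N) ⟩
      (b - a) * P z + E
        ≡⟨ solve 6 (λ pz a′ b′ z N K →
             ((N :- a′) :- (N :- b′)) :* pz :+ (b′ :- a′) :* ((N :- (N :- z)) :- K) :=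
             (b′ :- a′) :* (((pz :+ N) :- (N :- z)) :- K))
           ≡.refl (P z) a′ b′ z N K ⟩
      (b′ - a′) * (((P z + N) - (N - z)) - K)
        ≡⟨ cong (λ w → (b′ - a′) * (((P w + N) - (N - z)) - K)) (≡.sym (x-[x-y]≡y N z)) ⟩
      (b′ - a′) * mirror K P (N - z) ∎
      where
      open ℚₚ.≤-Reasoning
      a = N - b′
      b = N - a′
      E = (b′ - a′) * ((N - (N - z)) - K)
      0≤a : 0ℚ ℚ.≤ a
      0≤a = ≡.subst (ℚ._≤ a) (ℚₚ.+-inverseʳ N) (-‿antimono-≤ N b′≤N)
      a<z : a ℚ.< z
      a<z = ≡.subst (a ℚ.<_) (x-[x-y]≡y N z) (-‿antimono-< N N-z<b′)
      z<b : z ℚ.< b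
      z<b = ≡.subst (ℚ._< b) (x-[x-y]≡y N z) (-‿antimono-< N a′<N-z)
      b≤N : b ℚ.≤ N
      b≤N = ≡.subst (b ℚ.≤_) (ℚₚ.+-identityʳ N) (-‿antimono-≤ N 0≤a′)

  IsVertex-resp : ∀ {P Q z} → (∀ x → P x ≡ Q x) → IsVertex n P z → IsVertex n Q z
  IsVertex-resp {P} {Q} {z} P≗Q (z∈[0,N] , P-strict) = z∈[0,N] , λ a b 0≤a a<z z<b b≤N →
    ≡.subst₂ ℚ._<_ (cong₂ _+_ (cong ((b - z) *_) (P≗Q a)) (cong ((z - a) *_) (P≗Q b))) (cong ((b - a) *_) (P≗Q z))
      (P-strict a b 0≤a a<z z<b b≤N)

  IsVertex-mirror⁻¹ : ∀ K {P y} → IsVertex n (mirror K P) y → IsVertex n P (N - y)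
  IsVertex-mirror⁻¹ K {P} y-vertex = IsVertex-resp (mirror-involutive K P) (IsVertex-mirror (N - K) y-vertex)

  mirror-slope : ∀ K P {u v s} → s * (v - u) ≡ P v - P u →
    (- 1ℚ - s) * ((N - u) - (N - v)) ≡ mirror K P (N - u) - mirror K P (N - v)
  mirror-slope K P {u} {v} {s} slope = begin
    (- 1ℚ - s) * ((N - u) - (N - v))
      ≡⟨ solve 4 (λ s u v N → (:- con 1ℚ :- s) :* ((N :- u) :- (N :- v)) := :- (v :- u) :- s :* (v :- u)) ≡.refl s u v N ⟩
    - (v - u) - s * (v - u)
      ≡⟨ cong (λ w → - (v - u) - w) slope ⟩
    - (v - u) - (P v - P u)
      ≡⟨ solve 6 (λ pu pv u v N K → :- (v :- u) :- (pv :- pu) :=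
           (((pu :+ N) :- (N :- u)) :- K) :- (((pv :+ N) :- (N :- v)) :- K)) ≡.refl (P u) (P v) u v N K ⟩
    (((P u + N) - (N - u)) - K) - (((P v + N) - (N - v)) - K)
      ≡⟨ cong₂ (λ a b → (((P a + N) - (N - u)) - K) - (((P b + N) - (N - v)) - K))
           (≡.sym (x-[x-y]≡y N u)) (≡.sym (x-[x-y]≡y N v)) ⟩
    mirror K P (N - u) - mirror K P (N - v) ∎
    where open ≡.≡-Reasoning

  HasSlopes-mirror : ∀ K {P M μ} → HasSlopes n P M μ → HasSlopes n (mirror K P) M (λ i → - 1ℚ - μ (opposite i))
  HasSlopes-mirror K {P} {M} {μ} (μ-decreasing , x , x₀≡0 , x_M≡N , x-increasing , x-vertex , x-complete , x-slope) =
    (λ i j i<j → -‿antimono-< (- 1ℚ) (μ-decreasing _ _ (opposite-reverses-< i<j))) ,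
    x′ ,
    ≡.trans (cong (_-_ N) x_M≡N) (ℚₚ.+-inverseʳ N) ,
    ≡.trans (cong (λ i → N - x i) (opposite-fromℕ M)) (≡.trans (cong (_-_ N) x₀≡0) (ℚₚ.+-identityʳ N)) ,
    (λ i j i<j → -‿antimono-< N (x-increasing _ _ (opposite-reverses-< i<j))) ,
    (λ i → IsVertex-mirror K (x-vertex (opposite i))) ,
    x′-complete ,
    λ i → ≡.subst (λ j → (- 1ℚ - μ (opposite i)) * (x′ (suc i) - (N - x j)) ≡ mirror K P (x′ (suc i)) - mirror K P (N - x j))
                  (≡.sym (opposite-inject₁ i))
                  (mirror-slope K P {x (inject₁ (opposite i))} {x (suc (opposite i))} {μ (opposite i)} (x-slope (opposite i)))
    where
    x′ : Fin (suc M) → ℚ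
    x′ i = N - x (opposite i)
    x′-complete : ∀ y → IsVertex n (mirror K P) y → ∃ λ i → x′ i ≡ y
    x′-complete y y-vertex =
      let (i , xi≡N-y) = x-complete (N - y) (IsVertex-mirror⁻¹ K {P} y-vertex) in
      opposite i , ≡.trans (cong (λ j → N - x j) (Finₚ.opposite-involutive i)) (≡.trans (cong (_-_ N) xi≡N-y) (x-[x-y]≡y N y))

  ℕ→ℚ∣∁J∣ : ∀ J → ℕ→ℚ ∣ ∁ J ∣ ≡ N - ℕ→ℚ ∣ J ∣
  ℕ→ℚ∣∁J∣ J = begin
    ℕ→ℚ ∣ ∁ J ∣                               ≡⟨ solve 2 (λ c j → c := (c :+ j) :- j) ≡.refl (ℕ→ℚ ∣ ∁ J ∣) (ℕ→ℚ ∣ J ∣) ⟩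
    (ℕ→ℚ ∣ ∁ J ∣ + ℕ→ℚ ∣ J ∣) - ℕ→ℚ ∣ J ∣     ≡⟨ cong (_- ℕ→ℚ ∣ J ∣) (ℕ→ℚ-+ ∣ ∁ J ∣ ∣ J ∣) ⟨
    ℕ→ℚ (∣ ∁ J ∣ ℕ.+ ∣ J ∣) - ℕ→ℚ ∣ J ∣       ≡⟨ cong (λ m → ℕ→ℚ m - ℕ→ℚ ∣ J ∣) ∣∁J∣+∣J∣≡n ⟩
    N - ℕ→ℚ ∣ J ∣                             ∎
    where
    open ≡.≡-Reasoning
    ∣∁J∣+∣J∣≡n : ∣ ∁ J ∣ ℕ.+ ∣ J ∣ ≡ n
    ∣∁J∣+∣J∣≡n = ≡.trans (cong (ℕ._+ ∣ J ∣) (∣∁p∣≡n∸∣p∣ J)) (ℕₚ.m∸n+n≡m (∣p∣≤n J))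

  mirror-at : ∀ K Q J → mirror K Q (ℕ→ℚ ∣ J ∣) ≡ Q (ℕ→ℚ ∣ ∁ J ∣) + (ℕ→ℚ ∣ ∁ J ∣ - K)
  mirror-at K Q J = ≡.trans
    (solve 4 (λ q N j K → ((q :+ N) :- j) :- K := q :+ ((N :- j) :- K)) ≡.refl (Q (N - ℕ→ℚ ∣ J ∣)) N (ℕ→ℚ ∣ J ∣) K)
    (cong (λ c → Q c + (c - K)) (≡.sym (ℕ→ℚ∣∁J∣ J)))

  mirror-at-∁ : ∀ K Q J → mirror K Q (ℕ→ℚ ∣ ∁ J ∣) ≡ Q (ℕ→ℚ ∣ J ∣) + (ℕ→ℚ ∣ J ∣ - K)
  mirror-at-∁ K Q J = ≡.subst (λ I → mirror K Q (ℕ→ℚ ∣ ∁ J ∣) ≡ Q (ℕ→ℚ ∣ I ∣) + (ℕ→ℚ ∣ I ∣ - K)) (∁-involutive J) (mirror-at K Q (∁ J))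

  record DualDegrees (K : ℚ) (deg deg′ : Subset n → ℕ) : Set where
    constructor dualDegrees
    field deg′≡ : ∀ J → ℕ→ℚ (deg′ J) ≡ ℕ→ℚ (deg (∁ J)) + (ℕ→ℚ ∣ ∁ J ∣ - K)
  open DualDegrees

  DualDegrees-∁ : ∀ {K deg deg′} → DualDegrees K deg deg′ → ∀ J → ℕ→ℚ (deg′ (∁ J)) ≡ ℕ→ℚ (deg J) + (ℕ→ℚ ∣ J ∣ - K)
  DualDegrees-∁ {K} {deg} {deg′} dual J =
    ≡.subst (λ I → ℕ→ℚ (deg′ (∁ J)) ≡ ℕ→ℚ (deg I) + (ℕ→ℚ ∣ I ∣ - K)) (∁-involutive J) (deg′≡ dual (∁ J))

  DualDegrees-fromℕ : ∀ {k deg deg′} → (∀ J → deg′ J ℕ.+ k ≡ ∣ ∁ J ∣ ℕ.+ deg (∁ J)) → DualDegrees (ℕ→ℚ k) deg deg′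
  DualDegrees-fromℕ {k} {deg} {deg′} dim-identity = dualDegrees λ J → begin
    ℕ→ℚ (deg′ J)                                ≡⟨ solve 2 (λ d′ k → d′ := (d′ :+ k) :- k) ≡.refl (ℕ→ℚ (deg′ J)) (ℕ→ℚ k) ⟩
    (ℕ→ℚ (deg′ J) + ℕ→ℚ k) - ℕ→ℚ k              ≡⟨ cong (_- ℕ→ℚ k) (ℕ→ℚ-+ (deg′ J) k) ⟨
    ℕ→ℚ (deg′ J ℕ.+ k) - ℕ→ℚ k                  ≡⟨ cong (λ m → ℕ→ℚ m - ℕ→ℚ k) (dim-identity J) ⟩
    ℕ→ℚ (∣ ∁ J ∣ ℕ.+ deg (∁ J)) - ℕ→ℚ k         ≡⟨ cong (_- ℕ→ℚ k) (ℕ→ℚ-+ ∣ ∁ J ∣ (deg (∁ J))) ⟩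
    (ℕ→ℚ ∣ ∁ J ∣ + ℕ→ℚ (deg (∁ J))) - ℕ→ℚ k     ≡⟨ solve 3 (λ c d k → (c :+ d) :- k := d :+ (c :- k)) ≡.refl (ℕ→ℚ ∣ ∁ J ∣) (ℕ→ℚ (deg (∁ J))) (ℕ→ℚ k) ⟩
    ℕ→ℚ (deg (∁ J)) + (ℕ→ℚ ∣ ∁ J ∣ - ℕ→ℚ k)     ∎
    where open ≡.≡-Reasoning

  DualDegrees-sym : ∀ {K deg deg′} → DualDegrees K deg deg′ → DualDegrees (N - K) deg′ deg
  DualDegrees-sym {K} {deg} {deg′} dual = dualDegrees λ J → begin
    ℕ→ℚ (deg J)
      ≡⟨ solve 4 (λ d j N K → d := (d :+ (j :- K)) :+ ((N :- j) :- (N :- K))) ≡.refl (ℕ→ℚ (deg J)) (ℕ→ℚ ∣ J ∣) N K ⟩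
    (ℕ→ℚ (deg J) + (ℕ→ℚ ∣ J ∣ - K)) + ((N - ℕ→ℚ ∣ J ∣) - (N - K))
      ≡⟨ cong₂ (λ a b → a + (b - (N - K))) (≡.sym (DualDegrees-∁ dual J)) (≡.sym (ℕ→ℚ∣∁J∣ J)) ⟩
    ℕ→ℚ (deg′ (∁ J)) + (ℕ→ℚ ∣ ∁ J ∣ - (N - K))
      ∎
    where open ≡.≡-Reasoning

  Majorizes-mirror : ∀ {K deg deg′} → DualDegrees K deg deg′ → ∀ Q → Majorizes deg Q → Majorizes deg′ (mirror K Q)
  Majorizes-mirror {K} {deg} {deg′} dual Q Q-majorizes J = begin
    ℕ→ℚ (deg′ J)                                      ≡⟨ deg′≡ dual J ⟩
    ℕ→ℚ (deg (∁ J)) + (ℕ→ℚ ∣ ∁ J ∣ - K)                ≤⟨ ℚₚ.+-monoˡ-≤ _ (Q-majorizes (∁ J)) ⟩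
    Q (ℕ→ℚ ∣ ∁ J ∣) + (ℕ→ℚ ∣ ∁ J ∣ - K)                ≡⟨ mirror-at K Q J ⟨
    mirror K Q (ℕ→ℚ ∣ J ∣)                            ∎
    where open ℚₚ.≤-Reasoning

  IsCanonicalPolygon-mirror : ∀ {K deg deg′ P} → DualDegrees K deg deg′ →
    IsCanonicalPolygon n deg P → IsCanonicalPolygon n deg′ (mirror K P)
  IsCanonicalPolygon-mirror {K} {deg′ = deg′} {P} dual (P-concave , P-majorizes , P-least) =
    ConcaveOn-mirror K P-concave , Majorizes-mirror dual P P-majorizes , least
    where
    least : ∀ Q → ConcaveOn n Q → Majorizes deg′ Q → ∀ x → InRange n x → mirror K P x ℚ.≤ Q x
    least Q Q-concave Q-majorizes x x∈[0,N] = begin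
      mirror K P x                        ≤⟨ mirror-mono K (P-least (mirror (N - K) Q) (ConcaveOn-mirror (N - K) Q-concave)
                                               (Majorizes-mirror (DualDegrees-sym dual) Q Q-majorizes)) x x∈[0,N] ⟩
      mirror K (mirror (N - K) Q) x       ≡⟨ cong (λ K′ → mirror K′ (mirror (N - K) Q) x) (x-[x-y]≡y N K) ⟨
      mirror (N - (N - K)) (mirror (N - K) Q) x ≡⟨ mirror-involutive (N - K) Q x ⟩
      Q x                                 ∎
      where open ℚₚ.≤-Reasoning

  IsCanonicalFiltration-mirror : ∀ {K deg deg′ P M J} → DualDegrees K deg deg′ →
    IsCanonicalFiltration n deg P M J → IsCanonicalFiltration n deg′ (mirror K P) M (λ i → ∁ (J (opposite i)))
  IsCanonicalFiltration-mirror {K} {deg} {deg′} {P} {M} {J} dual (J₀≡⊥ , J_M≡⊤ , J-strict , J-vertex , J-complete , J-unique) =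
    ≡.trans (cong ∁ J_M≡⊤) ∁⊤≡⊥ ,
    ≡.trans (cong (λ i → ∁ (J i)) (opposite-fromℕ M)) (≡.trans (cong ∁ J₀≡⊥) ∁⊥≡⊤) ,
    (λ i → ≡.subst (λ j → ∁ (J j) ⊂ ∁ (J (inject₁ (opposite i)))) (≡.sym (opposite-inject₁ i))
                   (p⊂q⇒∁p⊃∁q (J-strict (opposite i)))) ,
    (λ i → ≡.subst (IsVertex n (mirror K P)) (≡.sym (ℕ→ℚ∣∁J∣ (J (opposite i)))) (IsVertex-mirror K (proj₁ (J-vertex (opposite i)))) ,
           vertex-value (J (opposite i)) (proj₂ (J-vertex (opposite i)))) ,
    complete ,
    unique
    where
    complete : ∀ y → IsVertex n (mirror K P) y → ∃ λ i → ℕ→ℚ ∣ ∁ (J (opposite i)) ∣ ≡ y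
    complete y y-vertex =
      let (i , ∣Ji∣≡N-y) = J-complete (N - y) (IsVertex-mirror⁻¹ K {P} y-vertex) in
      opposite i , ≡.trans (cong (λ j → ℕ→ℚ ∣ ∁ (J j) ∣) (Finₚ.opposite-involutive i))
                     (≡.trans (ℕ→ℚ∣∁J∣ (J i)) (≡.trans (cong (_-_ N) ∣Ji∣≡N-y) (x-[x-y]≡y N y)))
    vertex-value : ∀ L → P (ℕ→ℚ ∣ L ∣) ≡ ℕ→ℚ (deg L) → mirror K P (ℕ→ℚ ∣ ∁ L ∣) ≡ ℕ→ℚ (deg′ (∁ L))
    vertex-value L P∣L∣≡degL = begin
      mirror K P (ℕ→ℚ ∣ ∁ L ∣)           ≡⟨ mirror-at-∁ K P L ⟩
      P (ℕ→ℚ ∣ L ∣) + (ℕ→ℚ ∣ L ∣ - K)    ≡⟨ cong (_+ (ℕ→ℚ ∣ L ∣ - K)) P∣L∣≡degL ⟩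
      ℕ→ℚ (deg L) + (ℕ→ℚ ∣ L ∣ - K)      ≡⟨ DualDegrees-∁ dual L ⟨
      ℕ→ℚ (deg′ (∁ L))                   ∎
      where open ≡.≡-Reasoning
    unique : ∀ i I → ∣ I ∣ ≡ ∣ ∁ (J (opposite i)) ∣ → ℕ→ℚ (deg′ I) ≡ mirror K P (ℕ→ℚ ∣ I ∣) → I ≡ ∁ (J (opposite i))
    unique i I ∣I∣≡∣∁L∣ deg′I≡ = ≡.trans (≡.sym (∁-involutive I)) (cong ∁ (J-unique (opposite i) (∁ I)
      (∣p∣≡∣∁q∣⇒∣∁p∣≡∣q∣ {p = I} {J (opposite i)} ∣I∣≡∣∁L∣)
      (+-cancelʳ (ℕ→ℚ ∣ ∁ I ∣ - K) _ _ (≡.trans (≡.sym (deg′≡ dual I)) (≡.trans deg′I≡ (mirror-at K P I))))))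

theorem3p4 : ∀ {c ℓ p} (F : Field c ℓ) → let open LinearAlgebra F in
  (n k : ℕ) (C : Code n p) → HasDim (Code._∈C C) k →
  (degC degC⊥ : Subset n → ℕ) →
  (∀ J → HasDim (Restrict (Code._∈C C) J) (degC J)) →
  (∀ J → HasDim (Restrict (Dual C) J) (degC⊥ J)) →
  (P : ℚ → ℚ) → IsCanonicalPolygon n degC P →
  IsCanonicalPolygon n degC⊥ (λ x → ((P (ℕ→ℚ n - x) + ℕ→ℚ n) - x) - ℕ→ℚ k)
  × (∀ N (μ : Fin N → ℚ) → HasSlopes n P N μ →
       HasSlopes n (λ x → ((P (ℕ→ℚ n - x) + ℕ→ℚ n) - x) - ℕ→ℚ k) N
         (λ i → - 1ℚ - μ (opposite i)))
  × (∀ N (J : Fin (suc N) → Subset n) → IsCanonicalFiltration n degC P N J →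
       IsCanonicalFiltration n degC⊥ (λ x → ((P (ℕ→ℚ n - x) + ℕ→ℚ n) - x) - ℕ→ℚ k) N
         (λ i → ∁ (J (opposite i))))
theorem3p4 F n k C C-dim degC degC⊥ degC-dim degC⊥-dim P P-canonical =
  IsCanonicalPolygon-mirror n dual P-canonical ,
  (λ _ _ → HasSlopes-mirror n (ℕ→ℚ k)) ,
  (λ _ _ → IsCanonicalFiltration-mirror n dual)
  where
  dual : DualDegrees n (ℕ→ℚ k) degC degC⊥
  dual = DualDegrees-fromℕ n (λ J → dim-dual-restrict F C C-dim J (degC-dim (∁ J)) (degC⊥-dim J))
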